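{- Let $r\ge 2$, $n\ge 1$, and $0\le c<d\le r-1$. The number of colored permutations in $G_{r,n}$ with exactly $0$ $(c,d)$-descents is $$n!\sum_{i=0}^{n}(r-1)^i+n!\sum_{k=1}^{n-1}\sum_{b=1}^{k}\binom{k}{b}\binom{n-k}{b}(r-2)^{b}(r-1)^{n-k-b},$$ and for each integer $m>0$ the number of colored permutations in $G_{r,n}$ with exactly $m$ $(c,d)$-descents is $$n!\sum_{k=1}^{n-1}\sum_{b=1}^{k}\binom{k}{b}\binom{n-k}{b}\binom{b}{m}(r-2)^{b-m}(r-1)^{n-k-b}.$$
   Context: $G_{r,n}$ is the set of words $\pi=\pi_1^{[c_1]}\cdots\pi_n^{[c_n]}$ with $\pi_1\cdots\pi_n$ a permutation of $\{1,\dots,n\}$ and colors $c_i\in\{0,\dots,r-1\}$, with order $a^{[i]}<b^{[j]}$ iff $i>j$, or $i=j$ and $a<b$. A $(c,d)$-descent of $\pi$ is an index $i\in\{1,\dots,n-1\}$ with $\pi_i^{[c_i]}>\pi_{i+1}^{[c_{i+1}]}$, $c_i=c$, $c_{i+1}=d$. Convention: $0^0=1$. -}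

module Defs where

open import Data.Nat using (ℕ; zero; suc; _+_; _*_; _∸_; _^_; _<_)
open import Data.Nat.Combinatorics using (_C_)
open import Data.Fin using (Fin)
open import Data.Fin.Properties as FinP using ()
import Data.Fin as Fin
open import Data.Bool using (Bool; true; false; if_then_else_)
open import Data.Nat.ListAction using (sum)
open import Data.List using (List; []; _∷_; map; upTo; length; filter; concatMap; allFin)
open import Data.Vec using (Vec; []; _∷_; toList)
open import Data.Product using (_×_; _,_; proj₁; proj₂)
open import Data.Sum using (_⊎_)
open import Relation.Binary.PropositionalEquality using (_≡_)
open import Relation.Nullary using (Dec; does; _×-dec_; _⊎-dec_)
open import Data.List.Relation.Unary.Unique.Propositional using (Unique)
import Data.List.Relation.Unary.Unique.DecPropositional as UDec

-- A colored letter a^[i]: a letter a ∈ Fin n (standing for a+1 ∈ {1..n})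
-- together with a color i ∈ Fin r.
Letter : ℕ → ℕ → Set
Letter r n = Fin n × Fin r

Word : ℕ → ℕ → Set
Word r n = Vec (Letter r n) n

_<ᶜ_ : ∀ {r n} → Letter r n → Letter r n → Set
(a , i) <ᶜ (b , j) = (Fin.toℕ j < Fin.toℕ i) ⊎ ((i ≡ j) × (Fin.toℕ a < Fin.toℕ b))

_<ᶜ?_ : ∀ {r n} (x y : Letter r n) → Dec (x <ᶜ y)
(a , i) <ᶜ? (b , j) =
  (Fin.toℕ j Data.Nat.<? Fin.toℕ i) ⊎-dec ((i FinP.≟ j) ×-dec (Fin.toℕ a Data.Nat.<? Fin.toℕ b))

-- The word π ∈ G_{r,n}: underlying letters π₁⋯πₙ form a permutation,
-- i.e. the n letters (from an n-element alphabet) are pairwise distinct.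
IsColoredPerm : ∀ {r n} → Word r n → Set
IsColoredPerm w = Unique (map proj₁ (toList w))

isColoredPerm? : ∀ {r n} (w : Word r n) → Dec (IsColoredPerm w)
isColoredPerm? {r} {n} w = UDec.unique? FinP._≟_ (map proj₁ (toList w))

IsDesc : ∀ {r n} → Fin r → Fin r → Letter r n → Letter r n → Set
IsDesc c d x y = (y <ᶜ x) × ((proj₂ x ≡ c) × (proj₂ y ≡ d))

isDesc? : ∀ {r n} (c d : Fin r) (x y : Letter r n) → Dec (IsDesc c d x y)
isDesc? c d x y = (y <ᶜ? x) ×-dec ((proj₂ x FinP.≟ c) ×-dec (proj₂ y FinP.≟ d))

descList : ∀ {r n} → Fin r → Fin r → List (Letter r n) → ℕ
descList c d [] = 0
descList c d (x ∷ []) = 0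
descList c d (x ∷ y ∷ rest) =
  (if does (isDesc? c d x y) then 1 else 0) + descList c d (y ∷ rest)

desCount : ∀ {r n} → Fin r → Fin r → Word r n → ℕ
desCount c d w = descList c d (toList w)

allVecs : ∀ {A : Set} → List A → (k : ℕ) → List (Vec A k)
allVecs xs zero = [] ∷ []
allVecs xs (suc k) = concatMap (λ x → map (x ∷_) (allVecs xs k)) xs

allLetters : (r n : ℕ) → List (Letter r n)
allLetters r n = concatMap (λ a → map (a ,_) (allFin r)) (allFin n)

G : (r n : ℕ) → List (Word r n)
G r n = filter isColoredPerm? (allVecs (allLetters r n) n)

countDes : (r n : ℕ) → Fin r → Fin r → ℕ → ℕ
countDes r n c d m = length (filter (λ w → desCount c d w Data.Nat.≟ m) (G r n))

-- Σ_{i=lo}^{hi} f i  (empty if hi < lo)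
sumRange : ℕ → ℕ → (ℕ → ℕ) → ℕ
sumRange lo hi f = sum (map (λ i → f (lo + i)) (upTo (suc hi ∸ lo)))

formula0 : ℕ → ℕ → ℕ
formula0 r n =
  Data.Nat._! n * sumRange 0 n (λ i → (r ∸ 1) ^ i)
  + Data.Nat._! n * sumRange 1 (n ∸ 1) (λ k → sumRange 1 k (λ b →
      (k C b) * ((n ∸ k) C b) * (r ∸ 2) ^ b * (r ∸ 1) ^ (n ∸ k ∸ b)))

formulaM : ℕ → ℕ → ℕ → ℕ
formulaM r n m =
  Data.Nat._! n * sumRange 1 (n ∸ 1) (λ k → sumRange 1 k (λ b →
      (k C b) * ((n ∸ k) C b) * (b C m) * (r ∸ 2) ^ (b ∸ m) * (r ∸ 1) ^ (n ∸ k ∸ b)))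

module Submission where

-- Since c < d, every letter of colour c exceeds every letter of colour d in the coloured
-- order, so the (c,d)-descents of a coloured permutation are exactly its adjacent pairs of
-- colours (c,d).  Choosing the distinct letters from left to right, the number of coloured
-- permutations with m such pairs is n! times the number of colour words in [r]^n with m
-- factors cd.  Marking these factors by t, the colour-word counts O_k (after a colour other
-- than c) and C_k (after c) satisfy O_{k+1} = C_k + (r-1) O_k and C_{k+1} = C_k + (t+r-2) O_k.
-- Refined by the numbers k of letters of colour c and j of other colours, the words with b
-- runs of c followed by another colour weigh C(k,b) C(j,b) (t+r-2)^b (r-1)^(j-b); these
-- refined sums satisfy the recurrences by Pascal's rule, and the coefficient of t^m of their
-- total over k + j = n is the stated formula.

open import Defs
open import Data.Bool using (Bool; true; false; _∧_; not; if_then_else_)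
open import Data.Bool.Properties using (∧-zeroʳ; ∧-identityʳ)
open import Data.Fin using (Fin; toℕ; punchIn; punchOut)
import Data.Fin as Fin
open import Data.Fin.Properties using (_≟_; punchInᵢ≢i; punchIn-punchOut; punchIn-injective)
open import Data.List using (List; []; _∷_; map; concatMap; concat; length; filter; tabulate; allFin; applyUpTo; upTo)
open import Data.List.Properties using (map-cong; map-++; map-∘; map-tabulate; map-applyUpTo; length-map)
open import Data.List.Relation.Unary.All using (all?)
open import Data.List.Relation.Unary.AllPairs using ([]; _∷_)
open import Data.List.Relation.Unary.Unique.Propositional using (Unique)
import Data.List.Relation.Unary.Unique.DecPropositional as UniqueDec
open import Data.Nat using (ℕ; zero; suc; _+_; _*_; _∸_; _^_; _≤_; _<_; _<?_; _≡ᵇ_; _!; z≤n; s≤s; pred) renaming (_≟_ to _≟ℕ_)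
open import Data.Nat.Properties hiding (_≟_)
open import Data.Nat.Combinatorics using (_C_; nCk+nC[k+1]≡[n+1]C[k+1]; k>n⇒nCk≡0)
open import Data.Nat.Combinatorics.Base using (_P′_)
open import Data.Nat.Combinatorics.Specification using (nP′k≡n!/[n∸k]!)
open import Data.Nat.DivMod using (/-congʳ; n/1≡n)
open import Data.Nat.ListAction using (sum)
open import Data.Nat.ListAction.Properties using (sum-++)
open import Data.Nat.Tactic.RingSolver using (solve-∀)
open import Data.Product using (_×_; _,_; proj₁; proj₂)
open import Data.Sum using (inj₁; inj₂)
open import Data.Vec using (Vec; []; _∷_; toList)
open import Data.Vec.Properties using (length-toList)
open import Function using (_∘_)
open import Relation.Binary.PropositionalEquality
open import Relation.Nullary using (Dec; yes; no; does; ¬?)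
open import Relation.Nullary.Decidable using (dec-true; dec-false)
open import Algebra.Properties.CommutativeMonoid.Sum +-0-commutativeMonoid using (sum-syntax; sum-remove; sum-cong-≗)
open import Algebra.Properties.Semiring.Sum +-*-semiring using (*-distribˡ-sum; *-distribʳ-sum)
open import Algebra.Properties.CommutativeSemigroup +-commutativeSemigroup using () renaming (interchange to +-interchange; x∙yz≈y∙xz to x+[y+z]≡y+[x+z])
open import Algebra.Properties.CommutativeSemigroup *-commutativeSemigroup using () renaming (x∙yz≈y∙xz to x*[y*z]≡y*[x*z])

∑< : ℕ → (ℕ → ℕ) → ℕ
∑< N f = sum (applyUpTo f N)

sumRange≡∑< : ∀ lo hi f → sumRange lo hi f ≡ ∑< (suc hi ∸ lo) (λ i → f (lo + i))
sumRange≡∑< lo hi f = cong sum (map-applyUpTo (λ i → i) (λ i → f (lo + i)) (suc hi ∸ lo))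

sumRange-cong : ∀ lo hi {f g : ℕ → ℕ} → (∀ i → f i ≡ g i) → sumRange lo hi f ≡ sumRange lo hi g
sumRange-cong lo hi f≡g = cong sum (map-cong (λ i → f≡g (lo + i)) (upTo (suc hi ∸ lo)))

∑<-cong : ∀ N {f g : ℕ → ℕ} → (∀ i → i < N → f i ≡ g i) → ∑< N f ≡ ∑< N g
∑<-cong zero     f≡g = refl
∑<-cong (suc N) f≡g = cong₂ _+_ (f≡g 0 (s≤s z≤n)) (∑<-cong N (λ i i<N → f≡g (suc i) (s≤s i<N)))

∑<-zero : ∀ N {f : ℕ → ℕ} → (∀ i → i < N → f i ≡ 0) → ∑< N f ≡ 0
∑<-zero zero     f≡0 = refl
∑<-zero (suc N) f≡0 = cong₂ _+_ (f≡0 0 (s≤s z≤n)) (∑<-zero N (λ i i<N → f≡0 (suc i) (s≤s i<N)))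

∑<-last : ∀ N f → ∑< (suc N) f ≡ ∑< N f + f N
∑<-last zero     f = +-identityʳ (f 0)
∑<-last (suc N) f = trans (cong (f 0 +_) (∑<-last N (f ∘ suc))) (sym (+-assoc (f 0) _ _))

∑<-extend : ∀ {N M} f → N ≤ M → (∀ i → N ≤ i → f i ≡ 0) → ∑< N f ≡ ∑< M f
∑<-extend {M = zero} f z≤n vanish = refl
∑<-extend {N} {suc M} f N≤1+M vanish with m≤n⇒m<n∨m≡n N≤1+M
... | inj₂ refl       = refl
... | inj₁ (s≤s N≤M) = begin
  ∑< N f            ≡⟨ ∑<-extend f N≤M vanish ⟩
  ∑< M f            ≡⟨ +-identityʳ _ ⟨
  ∑< M f + 0        ≡⟨ cong (∑< M f +_) (vanish M N≤M) ⟨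
  ∑< M f + f M      ≡⟨ ∑<-last M f ⟨
  ∑< (suc M) f      ∎
  where open ≡-Reasoning

∑diag : ℕ → (ℕ → ℕ → ℕ) → ℕ
∑diag zero    f = f 0 0
∑diag (suc n) f = f 0 (suc n) + ∑diag n (λ a b → f (suc a) b)

∑diag-cong : ∀ n {f g : ℕ → ℕ → ℕ} → (∀ a b → f a b ≡ g a b) → ∑diag n f ≡ ∑diag n g
∑diag-cong zero    f≡g = f≡g 0 0
∑diag-cong (suc n) f≡g = cong₂ _+_ (f≡g 0 (suc n)) (∑diag-cong n (λ a b → f≡g (suc a) b))

∑diag-zero : ∀ n {f : ℕ → ℕ → ℕ} → (∀ a b → f a b ≡ 0) → ∑diag n f ≡ 0
∑diag-zero zero    f≡0 = f≡0 0 0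
∑diag-zero (suc n) f≡0 = cong₂ _+_ (f≡0 0 (suc n)) (∑diag-zero n (λ a b → f≡0 (suc a) b))

∑diag-+ : ∀ n (f g : ℕ → ℕ → ℕ) → ∑diag n (λ a b → f a b + g a b) ≡ ∑diag n f + ∑diag n g
∑diag-+ zero    f g = refl
∑diag-+ (suc n) f g = trans (cong (f 0 (suc n) + g 0 (suc n) +_) (∑diag-+ n _ _))
                            (+-interchange (f 0 (suc n)) (g 0 (suc n)) _ _)

∑diag-*ˡ : ∀ n k (f : ℕ → ℕ → ℕ) → ∑diag n (λ a b → k * f a b) ≡ k * ∑diag n f
∑diag-*ˡ zero    k f = refl
∑diag-*ˡ (suc n) k f = trans (cong (k * f 0 (suc n) +_) (∑diag-*ˡ n k _)) (sym (*-distribˡ-+ k _ _))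

∑diag-suc : ∀ n (f : ℕ → ℕ → ℕ) → ∑diag (suc n) f ≡ ∑diag n (λ a b → f a (suc b)) + f (suc n) 0
∑diag-suc zero    f = refl
∑diag-suc (suc n) f = trans (cong (f 0 (suc (suc n)) +_) (∑diag-suc n (λ a b → f (suc a) b)))
                            (sym (+-assoc (f 0 (suc (suc n))) _ _))

∑diag≡∑< : ∀ n (f : ℕ → ℕ → ℕ) → ∑diag n f ≡ ∑< (suc n) (λ a → f a (n ∸ a))
∑diag≡∑< zero    f = sym (+-identityʳ _)
∑diag≡∑< (suc n) f = cong (f 0 (suc n) +_) (∑diag≡∑< n (λ a b → f (suc a) b))

∑diag-reverse : ∀ n (g : ℕ → ℕ) → ∑diag n (λ _ b → g b) ≡ ∑< (suc n) g
∑diag-reverse zero    g = sym (+-identityʳ _)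
∑diag-reverse (suc n) g = begin
  g (suc n) + ∑diag n (λ _ b → g b)  ≡⟨ cong (g (suc n) +_) (∑diag-reverse n g) ⟩
  g (suc n) + ∑< (suc n) g           ≡⟨ +-comm (g (suc n)) _ ⟩
  ∑< (suc n) g + g (suc n)           ≡⟨ ∑<-last (suc n) g ⟨
  ∑< (suc (suc n)) g                 ∎
  where open ≡-Reasoning

⟦_⟧ : Bool → ℕ
⟦ b ⟧ = if b then 1 else 0

⟦∧⟧ : ∀ a b → ⟦ a ∧ b ⟧ ≡ ⟦ a ⟧ * ⟦ b ⟧
⟦∧⟧ true  b = sym (+-identityʳ ⟦ b ⟧)
⟦∧⟧ false b = refl

∑ᴸ : {A : Set} → List A → (A → ℕ) → ℕ
∑ᴸ xs f = sum (map f xs)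

infixl 10 ∑ᴸ
syntax ∑ᴸ xs (λ x → e) = ∑[ x ∈ xs ] e

module _ {A : Set} where

  ∑ᴸ-cong : ∀ xs {f g : A → ℕ} → (∀ x → f x ≡ g x) → ∑ᴸ xs f ≡ ∑ᴸ xs g
  ∑ᴸ-cong xs f≡g = cong sum (map-cong f≡g xs)

  ∑ᴸ-+ : ∀ xs (f g : A → ℕ) → ∑[ x ∈ xs ] (f x + g x) ≡ ∑ᴸ xs f + ∑ᴸ xs g
  ∑ᴸ-+ []       f g = refl
  ∑ᴸ-+ (x ∷ xs) f g = trans (cong (f x + g x +_) (∑ᴸ-+ xs f g)) (+-interchange (f x) (g x) _ _)

  ∑ᴸ-*ˡ : ∀ xs k (f : A → ℕ) → ∑[ x ∈ xs ] (k * f x) ≡ k * ∑ᴸ xs f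
  ∑ᴸ-*ˡ []       k f = sym (*-zeroʳ k)
  ∑ᴸ-*ˡ (x ∷ xs) k f = trans (cong (k * f x +_) (∑ᴸ-*ˡ xs k f)) (sym (*-distribˡ-+ k _ _))

  ∑ᴸ-zero : ∀ xs {f : A → ℕ} → (∀ x → f x ≡ 0) → ∑ᴸ xs f ≡ 0
  ∑ᴸ-zero []       f≡0 = refl
  ∑ᴸ-zero (x ∷ xs) f≡0 = cong₂ _+_ (f≡0 x) (∑ᴸ-zero xs f≡0)

  ∑ᴸ-concatMap : ∀ {B : Set} (xs : List B) (g : B → List A) (h : A → ℕ) →
    ∑ᴸ (concatMap g xs) h ≡ ∑[ x ∈ xs ] ∑ᴸ (g x) h
  ∑ᴸ-concatMap []       g h = refl
  ∑ᴸ-concatMap (x ∷ xs) g h = trans (cong sum (map-++ h (g x) (concat (map g xs))))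
    (trans (sum-++ (map h (g x)) _) (cong (∑ᴸ (g x) h +_) (∑ᴸ-concatMap xs g h)))

  ∑ᴸ-map : ∀ {B : Set} (xs : List B) (g : B → A) (h : A → ℕ) → ∑ᴸ (map g xs) h ≡ ∑[ x ∈ xs ] h (g x)
  ∑ᴸ-map xs g h = cong sum (sym (map-∘ xs))

  ∑-∑ᴸ-comm : ∀ n xs (f : Fin n → A → ℕ) → ∑[ a < n ] ∑[ x ∈ xs ] f a x ≡ ∑[ x ∈ xs ] ∑[ a < n ] f a x
  ∑-∑ᴸ-comm zero    xs f = sym (∑ᴸ-zero xs (λ _ → refl))
  ∑-∑ᴸ-comm (suc n) xs f = trans (cong (∑ᴸ xs (f Fin.zero) +_) (∑-∑ᴸ-comm n xs (f ∘ Fin.suc)))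
                                 (sym (∑ᴸ-+ xs (f Fin.zero) _))

∑ᴸ-allFin : ∀ n (f : Fin n → ℕ) → ∑ᴸ (allFin n) f ≡ ∑[ a < n ] f a
∑ᴸ-allFin n f = trans (cong sum (map-tabulate (λ a → a) f)) (sum-tabulate n f)
  where
  sum-tabulate : ∀ n (g : Fin n → ℕ) → sum (tabulate g) ≡ ∑[ a < n ] g a
  sum-tabulate zero    g = refl
  sum-tabulate (suc n) g = cong (g Fin.zero +_) (sum-tabulate n (g ∘ Fin.suc))

∑ᴸ-allLetters : ∀ {r n} (h : Letter r n → ℕ) → ∑ᴸ (allLetters r n) h ≡ ∑[ a < n ] ∑[ col < r ] h (a , col)
∑ᴸ-allLetters {r} {n} h = begin
  ∑ᴸ (allLetters r n) h
    ≡⟨ ∑ᴸ-concatMap (allFin n) (λ a → map (a ,_) (allFin r)) h ⟩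
  ∑[ a ∈ allFin n ] ∑ᴸ (map (a ,_) (allFin r)) h
    ≡⟨ ∑ᴸ-cong (allFin n) (λ a → trans (∑ᴸ-map (allFin r) (a ,_) h) (∑ᴸ-allFin r (λ col → h (a , col)))) ⟩
  ∑[ a ∈ allFin n ] ∑[ col < r ] h (a , col)
    ≡⟨ ∑ᴸ-allFin n (λ a → ∑[ col < r ] h (a , col)) ⟩
  ∑[ a < n ] ∑[ col < r ] h (a , col) ∎
  where open ≡-Reasoning

length-filter-filter : ∀ {X : Set} {P Q : X → Set} (P? : ∀ x → Dec (P x)) (Q? : ∀ x → Dec (Q x)) xs →
  length (filter P? (filter Q? xs)) ≡ ∑[ x ∈ xs ] (⟦ does (Q? x) ⟧ * ⟦ does (P? x) ⟧)
length-filter-filter P? Q? [] = refl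
length-filter-filter P? Q? (x ∷ xs) with does (Q? x)
... | false = length-filter-filter P? Q? xs
... | true with does (P? x)
...   | false = length-filter-filter P? Q? xs
...   | true  = cong suc (length-filter-filter P? Q? xs)

∑-const : ∀ n z → ∑[ _ < n ] z ≡ n * z
∑-const zero    z = refl
∑-const (suc n) z = cong (z +_) (∑-const n z)

∑-one-point : ∀ {r} (f : Fin r → ℕ) (c : Fin r) z → (∀ a → a ≢ c → f a ≡ z) →
  ∑[ a < r ] f a ≡ f c + (r ∸ 1) * z
∑-one-point {suc r} f c z others = trans (sum-remove {i = c} f)
  (cong (f c +_) (trans (sum-cong-≗ (λ j → others (punchIn c j) (punchInᵢ≢i c j))) (∑-const r z)))

∑-two-points : ∀ {r} (f : Fin r → ℕ) {c d : Fin r} z → c ≢ d → (∀ a → a ≢ c → a ≢ d → f a ≡ z) →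
  ∑[ a < r ] f a ≡ f c + (f d + (r ∸ 2) * z)
∑-two-points {suc r} f {c} {d} z c≢d others = begin
  ∑[ a < suc r ] f a
    ≡⟨ sum-remove {i = c} f ⟩
  f c + ∑[ j < r ] f (punchIn c j)
    ≡⟨ cong (f c +_) (∑-one-point (f ∘ punchIn c) (punchOut c≢d) z others′) ⟩
  f c + (f (punchIn c (punchOut c≢d)) + (r ∸ 1) * z)
    ≡⟨ cong (λ a → f c + (f a + (r ∸ 1) * z)) (punchIn-punchOut c≢d) ⟩
  f c + (f d + (r ∸ 1) * z) ∎
  where
  open ≡-Reasoning
  others′ : ∀ j → j ≢ punchOut c≢d → f (punchIn c j) ≡ z
  others′ j j≢d′ = others (punchIn c j) (punchInᵢ≢i c j)
    (λ eq → j≢d′ (punchIn-injective c j _ (trans eq (sym (punchIn-punchOut c≢d)))))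

infix 4 _∉ᵇ_
_∉ᵇ_ : ∀ {n} → Fin n → List (Fin n) → Bool
a ∉ᵇ as = does (all? (λ b → ¬? (a ≟ b)) as)

∑-∉ᵇ : ∀ {n} {as : List (Fin n)} → Unique as → ∑[ a < n ] ⟦ a ∉ᵇ as ⟧ ≡ n ∸ length as
∑-∉ᵇ {n} [] = trans (∑-const n 1) (*-identityʳ n)
∑-∉ᵇ {suc n} {u ∷ us} (u∉us ∷ unique-us) = begin
  ∑[ a < suc n ] ⟦ a ∉ᵇ u ∷ us ⟧
    ≡⟨ sum-remove {i = u} (λ a → ⟦ a ∉ᵇ u ∷ us ⟧) ⟩
  ⟦ u ∉ᵇ u ∷ us ⟧ + ∑[ j < n ] ⟦ punchIn u j ∉ᵇ u ∷ us ⟧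
    ≡⟨ cong₂ _+_ (cong (λ b → ⟦ not b ∧ (u ∉ᵇ us) ⟧) (dec-true (u ≟ u) refl))
                 (sum-cong-≗ (λ j → cong (λ b → ⟦ not b ∧ (punchIn u j ∉ᵇ us) ⟧)
                                         (dec-false (punchIn u j ≟ u) (punchInᵢ≢i u j)))) ⟩
  pred (⟦ true ⟧ + ∑[ j < n ] ⟦ punchIn u j ∉ᵇ us ⟧)
    ≡⟨ cong (λ b → pred (⟦ b ⟧ + ∑[ j < n ] ⟦ punchIn u j ∉ᵇ us ⟧))
            (dec-true (all? (λ b → ¬? (u ≟ b)) us) u∉us) ⟨
  pred (⟦ u ∉ᵇ us ⟧ + ∑[ j < n ] ⟦ punchIn u j ∉ᵇ us ⟧)
    ≡⟨ cong pred (trans (sym (sum-remove {i = u} (λ a → ⟦ a ∉ᵇ us ⟧))) (∑-∉ᵇ unique-us)) ⟩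
  pred (suc n ∸ length us)
    ≡⟨ pred[m∸n]≡m∸[1+n] (suc n) (length us) ⟩
  suc n ∸ length (u ∷ us) ∎
  where open ≡-Reasoning

δ₀ : ℕ → ℕ
δ₀ zero    = 1
δ₀ (suc _) = 0

shift : (ℕ → ℕ) → ℕ → ℕ
shift f zero    = 0
shift f (suc m) = f m

shiftIf : Bool → (ℕ → ℕ) → ℕ → ℕ
shiftIf false f = f
shiftIf true  f = shift f

shiftIf-cong : ∀ δ {f g : ℕ → ℕ} → (∀ m → f m ≡ g m) → ∀ m → shiftIf δ f m ≡ shiftIf δ g m
shiftIf-cong false f≡g m       = f≡g m
shiftIf-cong true  f≡g zero    = refl
shiftIf-cong true  f≡g (suc m) = f≡g m

shiftIf-*ˡ : ∀ δ k (f : ℕ → ℕ) m → shiftIf δ (λ i → k * f i) m ≡ k * shiftIf δ f m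
shiftIf-*ˡ false k f m       = refl
shiftIf-*ˡ true  k f zero    = sym (*-zeroʳ k)
shiftIf-*ˡ true  k f (suc m) = refl

∑ᴸ-shiftIf : ∀ {V : Set} (vs : List V) (g D : V → ℕ) δ m →
  ∑[ v ∈ vs ] (g v * ⟦ ⟦ δ ⟧ + D v ≡ᵇ m ⟧) ≡ shiftIf δ (λ i → ∑[ v ∈ vs ] (g v * ⟦ D v ≡ᵇ i ⟧)) m
∑ᴸ-shiftIf vs g D false m       = refl
∑ᴸ-shiftIf vs g D true  zero    = ∑ᴸ-zero vs (λ v → *-zeroʳ (g v))
∑ᴸ-shiftIf vs g D true  (suc m) = refl

module _ (L : (ℕ → ℕ) → ℕ → ℕ) (L-+ : ∀ f g m → L (λ i → f i + g i) m ≡ L f m + L g m) where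

  ∑diag-commute : ∀ n (B : ℕ → ℕ → ℕ → ℕ) m →
    L (λ i → ∑diag n (λ k j → B k j i)) m ≡ ∑diag n (λ k j → L (B k j) m)
  ∑diag-commute zero    B m = refl
  ∑diag-commute (suc n) B m = trans (L-+ (B 0 (suc n)) _ m)
                                    (cong (L (B 0 (suc n)) m +_) (∑diag-commute n (B ∘ suc) m))

  ∑diag-recurrence : (F A B : ℕ → ℕ → ℕ → ℕ) →
    (∀ j m → F 0 (suc j) m ≡ L (B 0 j) m) →
    (∀ k m → F (suc k) 0 m ≡ A k 0 m) →
    (∀ k j m → F (suc k) (suc j) m ≡ A k (suc j) m + L (B (suc k) j) m) →
    ∀ n m → ∑diag (suc n) (λ k j → F k j m)
          ≡ ∑diag n (λ k j → A k j m) + L (λ i → ∑diag n (λ k j → B k j i)) m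
  ∑diag-recurrence F A B F0 Fk0 Fkj zero m = trans (cong₂ _+_ (F0 0 m) (Fk0 0 m)) (+-comm (L (B 0 0) m) (A 0 0 m))
  ∑diag-recurrence F A B F0 Fk0 Fkj (suc n) m = begin
    F 0 (suc (suc n)) m + ∑diag (suc n) (λ k j → F (suc k) j m)
      ≡⟨ cong₂ _+_ (F0 (suc n) m) (∑diag-suc n (λ k j → F (suc k) j m)) ⟩
    L₀ + (∑diag n (λ k j → F (suc k) (suc j) m) + F (suc (suc n)) 0 m)
      ≡⟨ cong₂ (λ x y → L₀ + (x + y))
           (trans (∑diag-cong n (λ k j → Fkj k j m)) (∑diag-+ n _ _)) (Fk0 (suc n) m) ⟩
    L₀ + ((∑diag n (λ k j → A k (suc j) m) + ∑diag n (λ k j → L (B (suc k) j) m)) + A (suc n) 0 m)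
      ≡⟨ regroup L₀ (∑diag n (λ k j → A k (suc j) m)) (∑diag n (λ k j → L (B (suc k) j) m)) (A (suc n) 0 m) ⟩
    (∑diag n (λ k j → A k (suc j) m) + A (suc n) 0 m) + (L₀ + ∑diag n (λ k j → L (B (suc k) j) m))
      ≡⟨ cong₂ _+_ (∑diag-suc n (λ k j → A k j m)) (∑diag-commute (suc n) B m) ⟨
    ∑diag (suc n) (λ k j → A k j m) + L (λ i → ∑diag (suc n) (λ k j → B k j i)) m ∎
    where
    open ≡-Reasoning
    L₀ = L (B 0 (suc n)) m
    regroup : ∀ a x y z → a + ((x + y) + z) ≡ (x + z) + (a + y)
    regroup = solve-∀

module Transfer (p q : ℕ) where

  -- Functions ℕ → ℕ are coefficient sequences of polynomials in t.

  [t+p]*_⟨_⟩ : (ℕ → ℕ) → ℕ → ℕ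
  [t+p]* f ⟨ m ⟩ = shift f m + p * f m

  [t+p]^_⟨_⟩ : ℕ → ℕ → ℕ
  [t+p]^ zero  ⟨ m ⟩ = δ₀ m
  [t+p]^ suc b ⟨ m ⟩ = [t+p]* [t+p]^ b ⟨_⟩ ⟨ m ⟩

  [t+p]*-+ : ∀ f g m → [t+p]* (λ i → f i + g i) ⟨ m ⟩ ≡ [t+p]* f ⟨ m ⟩ + [t+p]* g ⟨ m ⟩
  [t+p]*-+ f g zero    = *-distribˡ-+ p (f 0) (g 0)
  [t+p]*-+ f g (suc m) = lemma (f m) (g m) p (f (suc m)) (g (suc m))
    where
    lemma : ∀ a b p c d → a + b + p * (c + d) ≡ a + p * c + (b + p * d)
    lemma = solve-∀

  [t+p]*-scale : ∀ x y f m → [t+p]* (λ i → x * f i * y) ⟨ m ⟩ ≡ x * [t+p]* f ⟨ m ⟩ * y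
  [t+p]*-scale x y f zero    = lemma x y p (f 0)
    where
    lemma : ∀ x y p a → p * (x * a * y) ≡ x * (p * a) * y
    lemma = solve-∀
  [t+p]*-scale x y f (suc m) = lemma x y p (f m) (f (suc m))
    where
    lemma : ∀ x y p a b → x * a * y + p * (x * b * y) ≡ x * (a + p * b) * y
    lemma = solve-∀

  [t+p]^-coeff : ∀ b m → [t+p]^ b ⟨ m ⟩ ≡ (b C m) * p ^ (b ∸ m)
  [t+p]^-coeff zero    zero    = refl
  [t+p]^-coeff zero    (suc m) = refl
  [t+p]^-coeff (suc b) zero    = trans (cong (p *_) ([t+p]^-coeff b zero)) (lemma p (p ^ b))
    where
    lemma : ∀ p x → p * (1 * x) ≡ 1 * (p * x)
    lemma = solve-∀
  [t+p]^-coeff (suc b) (suc m) = begin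
    [t+p]^ b ⟨ m ⟩ + p * [t+p]^ b ⟨ suc m ⟩
      ≡⟨ cong₂ _+_ ([t+p]^-coeff b m) (cong (p *_) ([t+p]^-coeff b (suc m))) ⟩
    (b C m) * p ^ (b ∸ m) + p * ((b C suc m) * p ^ (b ∸ suc m))
      ≡⟨ cong ((b C m) * p ^ (b ∸ m) +_) absorb-p ⟩
    (b C m) * p ^ (b ∸ m) + (b C suc m) * p ^ (b ∸ m)
      ≡⟨ *-distribʳ-+ (p ^ (b ∸ m)) (b C m) (b C suc m) ⟨
    ((b C m) + (b C suc m)) * p ^ (b ∸ m)
      ≡⟨ cong (_* p ^ (b ∸ m)) (nCk+nC[k+1]≡[n+1]C[k+1] b m) ⟩
    (suc b C suc m) * p ^ (b ∸ m) ∎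
    where
    open ≡-Reasoning
    absorb-p : p * ((b C suc m) * p ^ (b ∸ suc m)) ≡ (b C suc m) * p ^ (b ∸ m)
    absorb-p with suc m ≤? b
    ... | yes m<b = trans (x*[y*z]≡y*[x*z] p (b C suc m) _)
                          (cong (λ e → (b C suc m) * p ^ e) (sym (+-∸-assoc 1 m<b)))
    ... | no m≮b rewrite k>n⇒nCk≡0 (≰⇒> m≮b) = *-zeroʳ p

  -- walkO k j and walkC k j count the colour words with k letters of colour c and j of other
  -- colours, read after a colour other than c, resp. after c: the exponent of t + p is the
  -- number of runs of c (including a preceding c) followed by another colour, that of q the
  -- number of the remaining letters of other colours.
  walkO walkC : ℕ → ℕ → ℕ → ℕ
  walkO k j m = ∑diag j (λ b i → (k C b) * ((b + i) C b) * [t+p]^ b ⟨ m ⟩ * q ^ i)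
  walkC k zero    m = δ₀ m
  walkC k (suc j) m = ∑diag j (λ b i → (suc k C suc b) * ((b + i) C b) * [t+p]^ suc b ⟨ m ⟩ * q ^ i)

  walkO-zero : ∀ j m → walkO 0 j m ≡ δ₀ m * q ^ j
  walkO-zero zero    m = cong (_* 1) (*-identityˡ (δ₀ m))
  walkO-zero (suc j) m = trans (cong₂ _+_ (cong (_* q ^ suc j) (*-identityˡ (δ₀ m))) (∑diag-zero j (λ _ _ → refl)))
                               (+-identityʳ _)

  walkO-zero-suc : ∀ j m → walkO 0 (suc j) m ≡ q * walkO 0 j m
  walkO-zero-suc j m = begin
    walkO 0 (suc j) m    ≡⟨ walkO-zero (suc j) m ⟩
    δ₀ m * (q * q ^ j)   ≡⟨ x*[y*z]≡y*[x*z] (δ₀ m) q (q ^ j) ⟩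
    q * (δ₀ m * q ^ j)   ≡⟨ cong (q *_) (walkO-zero j m) ⟨
    q * walkO 0 j m      ∎
    where
    open ≡-Reasoning

  walkO-suc-zero : ∀ k m → walkO (suc k) 0 m ≡ walkC k 0 m
  walkO-suc-zero k m = trans (*-identityʳ _) (*-identityˡ (δ₀ m))

  q*walkO : ∀ k j m → q * walkO k j m
          ≡ (k C 0) * (suc j C 0) * [t+p]^ 0 ⟨ m ⟩ * q ^ suc j
            + ∑diag j (λ b i → (k C suc b) * ((b + i) C suc b) * [t+p]^ suc b ⟨ m ⟩ * q ^ i)
  q*walkO k j m = begin
    q * walkO k j m
      ≡⟨ ∑diag-*ˡ j q _ ⟨
    ∑diag j (λ b i → q * ((k C b) * ((b + i) C b) * [t+p]^ b ⟨ m ⟩ * q ^ i))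
      ≡⟨ ∑diag-cong j shifted ⟩
    ∑diag j (λ b i → E b (suc i))
      ≡⟨ +-identityʳ _ ⟨
    ∑diag j (λ b i → E b (suc i)) + 0
      ≡⟨ cong (∑diag j (λ b i → E b (suc i)) +_) (vanishes j) ⟨
    ∑diag j (λ b i → E b (suc i)) + E (suc j) 0
      ≡⟨ ∑diag-suc j E ⟨
    ∑diag (suc j) E ∎
    where
    open ≡-Reasoning
    E : ℕ → ℕ → ℕ
    E zero    i = (k C 0) * (i C 0) * [t+p]^ 0 ⟨ m ⟩ * q ^ i
    E (suc b) i = (k C suc b) * ((b + i) C suc b) * [t+p]^ suc b ⟨ m ⟩ * q ^ i
    vanishes : ∀ b → E (suc b) 0 ≡ 0
    vanishes b rewrite +-identityʳ b | k>n⇒nCk≡0 (n<1+n b) | *-zeroʳ (k C suc b) = refl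
    reassoc : ∀ q a c y t → q * (a * c * y * t) ≡ a * c * y * (q * t)
    reassoc = solve-∀
    shifted : ∀ b i → q * ((k C b) * ((b + i) C b) * [t+p]^ b ⟨ m ⟩ * q ^ i) ≡ E b (suc i)
    shifted zero    i = reassoc q (k C 0) 1 (δ₀ m) (q ^ i)
    shifted (suc b) i = trans (reassoc q (k C suc b) _ _ _)
      (cong (λ x → (k C suc b) * (x C suc b) * [t+p]^ suc b ⟨ m ⟩ * q ^ suc i) (sym (+-suc b i)))

  walkO-suc-suc : ∀ k j m → walkO (suc k) (suc j) m ≡ walkC k (suc j) m + q * walkO (suc k) j m
  walkO-suc-suc k j m = begin
    walkO (suc k) (suc j) m
      ≡⟨ cong (E₀ +_) (∑diag-cong j (λ b i →
           trans (cong (λ x → (suc k C suc b) * x * [t+p]^ suc b ⟨ m ⟩ * q ^ i)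
                       (sym (nCk+nC[k+1]≡[n+1]C[k+1] (b + i) b)))
                 (distrib (suc k C suc b) ((b + i) C b) ((b + i) C suc b) _ _))) ⟩
    E₀ + ∑diag j (λ b i → g b i + h b i)
      ≡⟨ cong (E₀ +_) (∑diag-+ j g h) ⟩
    E₀ + (∑diag j g + ∑diag j h)
      ≡⟨ x+[y+z]≡y+[x+z] E₀ (∑diag j g) (∑diag j h) ⟩
    ∑diag j g + (E₀ + ∑diag j h)
      ≡⟨ cong (∑diag j g +_) (q*walkO (suc k) j m) ⟨
    walkC k (suc j) m + q * walkO (suc k) j m ∎
    where
    open ≡-Reasoning
    E₀ = (suc k C 0) * (suc j C 0) * [t+p]^ 0 ⟨ m ⟩ * q ^ suc j
    g h : ℕ → ℕ → ℕ
    g b i = (suc k C suc b) * ((b + i) C b) * [t+p]^ suc b ⟨ m ⟩ * q ^ i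
    h b i = (suc k C suc b) * ((b + i) C suc b) * [t+p]^ suc b ⟨ m ⟩ * q ^ i
    distrib : ∀ a c c′ y t → a * (c + c′) * y * t ≡ a * c * y * t + a * c′ * y * t
    distrib = solve-∀

  [t+p]*walkO : ∀ k j m →
    [t+p]* walkO k j ⟨ m ⟩ ≡ ∑diag j (λ b i → (k C b) * ((b + i) C b) * [t+p]^ suc b ⟨ m ⟩ * q ^ i)
  [t+p]*walkO k j m =
    trans (∑diag-commute [t+p]*_⟨_⟩ [t+p]*-+ j (λ b i m′ → (k C b) * ((b + i) C b) * [t+p]^ b ⟨ m′ ⟩ * q ^ i) m)
          (∑diag-cong j (λ b i → [t+p]*-scale ((k C b) * ((b + i) C b)) (q ^ i) [t+p]^ b ⟨_⟩ m))

  walkC-zero-suc : ∀ j m → walkC 0 (suc j) m ≡ [t+p]* walkO 0 j ⟨ m ⟩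
  walkC-zero-suc j m = trans (∑diag-cong j (λ b i → cong (λ x → x * ((b + i) C b) * [t+p]^ suc b ⟨ m ⟩ * q ^ i) (1C[1+b]≡0Cb b)))
                             (sym ([t+p]*walkO 0 j m))
    where
    1C[1+b]≡0Cb : ∀ b → 1 C suc b ≡ 0 C b
    1C[1+b]≡0Cb zero    = refl
    1C[1+b]≡0Cb (suc b) = refl

  walkC-suc-suc : ∀ k j m → walkC (suc k) (suc j) m ≡ walkC k (suc j) m + [t+p]* walkO (suc k) j ⟨ m ⟩
  walkC-suc-suc k j m = begin
    walkC (suc k) (suc j) m
      ≡⟨ ∑diag-cong j (λ b i →
           trans (cong (λ x → x * ((b + i) C b) * [t+p]^ suc b ⟨ m ⟩ * q ^ i)
                       (sym (nCk+nC[k+1]≡[n+1]C[k+1] (suc k) b)))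
                 (distrib (suc k C b) (suc k C suc b) ((b + i) C b) _ _)) ⟩
    ∑diag j (λ b i → g b i + h b i)
      ≡⟨ ∑diag-+ j g h ⟩
    ∑diag j g + ∑diag j h
      ≡⟨ cong (∑diag j g +_) ([t+p]*walkO (suc k) j m) ⟨
    walkC k (suc j) m + [t+p]* walkO (suc k) j ⟨ m ⟩ ∎
    where
    open ≡-Reasoning
    g h : ℕ → ℕ → ℕ
    g b i = (suc k C suc b) * ((b + i) C b) * [t+p]^ suc b ⟨ m ⟩ * q ^ i
    h b i = (suc k C b) * ((b + i) C b) * [t+p]^ suc b ⟨ m ⟩ * q ^ i
    distrib : ∀ a a′ c y t → (a + a′) * c * y * t ≡ a′ * c * y * t + a * c * y * t
    distrib = solve-∀

  walksO walksC : ℕ → ℕ → ℕ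
  walksO n m = ∑diag n (λ k j → walkO k j m)
  walksC n m = ∑diag n (λ k j → walkC k j m)

  walksO-suc : ∀ n m → walksO (suc n) m ≡ walksC n m + q * walksO n m
  walksO-suc = ∑diag-recurrence (λ f m → q * f m) (λ f g m → *-distribˡ-+ q (f m) (g m))
                 walkO walkC walkO walkO-zero-suc walkO-suc-zero walkO-suc-suc

  walksC-suc : ∀ n m → walksC (suc n) m ≡ walksC n m + [t+p]* walksO n ⟨ m ⟩
  walksC-suc = ∑diag-recurrence [t+p]*_⟨_⟩ [t+p]*-+
                 walkC walkC walkO walkC-zero-suc (λ _ _ → refl) walkC-suc-suc

  term : ℕ → ℕ → ℕ → ℕ → ℕ
  term k j b m = (k C b) * (j C b) * [t+p]^ b ⟨ m ⟩ * q ^ (j ∸ b)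

  term-vanishesˡ : ∀ {k b} j m → k ≤ b → term k j (suc b) m ≡ 0
  term-vanishesˡ j m k≤b rewrite k>n⇒nCk≡0 (s≤s k≤b) = refl

  term-vanishesʳ : ∀ k {j b} m → j ≤ b → term k j (suc b) m ≡ 0
  term-vanishesʳ k {j} {b} m j≤b rewrite k>n⇒nCk≡0 (s≤s j≤b) =
    cong (λ x → x * [t+p]^ suc b ⟨ m ⟩ * q ^ (j ∸ suc b)) (*-zeroʳ (k C suc b))

  walkO≡∑< : ∀ k j m → walkO k j m ≡ δ₀ m * q ^ j + ∑< j (λ b → term k j (suc b) m)
  walkO≡∑< k zero    m = trans (cong (_* 1) (*-identityˡ (δ₀ m))) (sym (+-identityʳ _))
  walkO≡∑< k (suc j) m = cong₂ _+_ (cong (_* q ^ suc j) (*-identityˡ (δ₀ m)))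
    (trans (∑diag≡∑< j _) (∑<-cong (suc j) (λ b b<1+j →
      cong (λ x → (k C suc b) * (suc x C suc b) * [t+p]^ suc b ⟨ m ⟩ * q ^ (j ∸ b))
           (m+[n∸m]≡n (≤-pred b<1+j)))))

  -- The summands with k = 0 or k = n vanish, and so do those whose binomial index exceeds k or n ∸ k.
  ∑term-trim : ∀ n′ m → let n = suc n′ in
         ∑< (suc n) (λ k → ∑< (n ∸ k) (λ b → term k (n ∸ k) (suc b) m))
       ≡ ∑< n′ (λ k → ∑< (suc k) (λ b → term (suc k) (n ∸ suc k) (suc b) m))
  ∑term-trim n′ m = begin
    ∑< (suc n) (λ k → ∑< (n ∸ k) (T k))
      ≡⟨ ∑<-cong (suc n) (λ k _ → ∑<-extend (T k) (m∸n≤m n k) (λ b → term-vanishesʳ k m)) ⟩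
    ∑< (suc n) (λ k → ∑< n (T k))
      ≡⟨ cong (_+ ∑< n (λ k → ∑< n (T (suc k)))) (∑<-zero n (λ _ _ → refl)) ⟩
    ∑< n (λ k → ∑< n (T (suc k)))
      ≡⟨ ∑<-last n′ (λ k → ∑< n (T (suc k))) ⟩
    ∑< n′ (λ k → ∑< n (T (suc k))) + ∑< n (T n)
      ≡⟨ cong (∑< n′ (λ k → ∑< n (T (suc k))) +_)
              (∑<-zero n (λ b _ → term-vanishesʳ n m (subst (_≤ b) (sym (n∸n≡0 n)) z≤n))) ⟩
    ∑< n′ (λ k → ∑< n (T (suc k))) + 0
      ≡⟨ +-identityʳ _ ⟩
    ∑< n′ (λ k → ∑< n (T (suc k)))
      ≡⟨ ∑<-cong n′ (λ k k<n′ → sym (∑<-extend (T (suc k)) (<⇒≤ (s≤s k<n′)) (λ b → term-vanishesˡ (n ∸ suc k) m))) ⟩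
    ∑< n′ (λ k → ∑< (suc k) (T (suc k))) ∎
    where
    open ≡-Reasoning
    n = suc n′
    T : ℕ → ℕ → ℕ
    T k b = term k (n ∸ k) (suc b) m

  walksO-closed : ∀ n′ m → let n = suc n′ in
    walksO n m ≡ δ₀ m * sumRange 0 n (q ^_)
                 + sumRange 1 n′ (λ k → sumRange 1 k (λ b → (k C b) * ((n ∸ k) C b) * [t+p]^ b ⟨ m ⟩ * q ^ (n ∸ k ∸ b)))
  walksO-closed n′ m = begin
    walksO n m
      ≡⟨ ∑diag-cong n (λ k j → walkO≡∑< k j m) ⟩
    ∑diag n (λ k j → δ₀ m * q ^ j + ∑< j (λ b → term k j (suc b) m))
      ≡⟨ ∑diag-+ n (λ _ j → δ₀ m * q ^ j) (λ k j → ∑< j (λ b → term k j (suc b) m)) ⟩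
    ∑diag n (λ _ j → δ₀ m * q ^ j) + ∑diag n (λ k j → ∑< j (λ b → term k j (suc b) m))
      ≡⟨ cong₂ _+_ (trans (∑diag-*ˡ n (δ₀ m) (λ _ j → q ^ j)) (cong (δ₀ m *_) (∑diag-reverse n (q ^_))))
                   (trans (∑diag≡∑< n (λ k j → ∑< j (λ b → term k j (suc b) m))) (∑term-trim n′ m)) ⟩
    δ₀ m * ∑< (suc n) (q ^_) + ∑< n′ (λ k → ∑< (suc k) (λ b → term (suc k) (n ∸ suc k) (suc b) m))
      ≡⟨ cong₂ _+_ (cong (δ₀ m *_) (sumRange≡∑< 0 n (q ^_)))
                   (trans (sumRange≡∑< 1 n′ (λ k → sumRange 1 k (t k)))
                          (∑<-cong n′ (λ k _ → sumRange≡∑< 1 (suc k) (t (suc k))))) ⟨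
    δ₀ m * sumRange 0 n (q ^_) + sumRange 1 n′ (λ k → sumRange 1 k (t k)) ∎
    where
    open ≡-Reasoning
    n = suc n′
    t : ℕ → ℕ → ℕ
    t k b = (k C b) * ((n ∸ k) C b) * [t+p]^ b ⟨ m ⟩ * q ^ (n ∸ k ∸ b)

module Colourings {r} (c d : Fin r) where

  isC isD : Fin r → Bool
  isC a = does (a ≟ c)
  isD a = does (a ≟ d)

  -- colourings s k m is the number of colour words of length k with m factors cd, where a
  -- leading d also counts when s (the word follows colour c).
  colourings : Bool → ℕ → ℕ → ℕ
  colourings s zero    m = δ₀ m
  colourings s (suc k) m = ∑[ a < r ] shiftIf (s ∧ isD a) (colourings (isC a) k) m

  colourings-suc : c ≢ d → ∀ s k m → colourings s (suc k) m
    ≡ colourings true k m + (shiftIf s (colourings false k) m + (r ∸ 2) * colourings false k m)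
  colourings-suc c≢d s k m =
    trans (∑-two-points F (colourings false k m) c≢d others) (cong₂ (λ x y → x + (y + _)) F-c F-d)
    where
    F : Fin r → ℕ
    F a = shiftIf (s ∧ isD a) (colourings (isC a) k) m
    F-c : F c ≡ colourings true k m
    F-c rewrite dec-true (c ≟ c) refl | dec-false (c ≟ d) c≢d | ∧-zeroʳ s = refl
    F-d : F d ≡ shiftIf s (colourings false k) m
    F-d rewrite dec-false (d ≟ c) (c≢d ∘ sym) | dec-true (d ≟ d) refl | ∧-identityʳ s = refl
    others : ∀ a → a ≢ c → a ≢ d → F a ≡ colourings false k m
    others a a≢c a≢d rewrite dec-false (a ≟ c) a≢c | dec-false (a ≟ d) a≢d | ∧-zeroʳ s = refl

module Counting {r n : ℕ} (c d : Fin r) where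

  open Colourings c d

  cdPairs : Bool → List (Letter r n) → ℕ
  cdPairs s []       = 0
  cdPairs s (x ∷ xs) = ⟦ s ∧ isD (proj₂ x) ⟧ + cdPairs (isC (proj₂ x)) xs

  -- A larger colour means a smaller letter, so whatever the letters a (c,d) pair descends.
  descent⇔cd-colours : toℕ c < toℕ d → ∀ (x y : Letter r n) → does (isDesc? c d x y) ≡ isC (proj₂ x) ∧ isD (proj₂ y)
  descent⇔cd-colours c<d (a , i) (b , j) = colours (i ≟ c) (j ≟ d)
    where
    colours : ∀ {i j} (i≟c : Dec (i ≡ c)) (j≟d : Dec (j ≡ d)) →
      does ((b , j) <ᶜ? (a , i)) ∧ (does i≟c ∧ does j≟d) ≡ does i≟c ∧ does j≟d
    colours (yes refl) (yes refl) rewrite dec-true (toℕ c <? toℕ d) c<d = refl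
    colours (yes refl) (no _)     = ∧-zeroʳ _
    colours (no _)     _          = ∧-zeroʳ _

  descList≡cdPairs : toℕ c < toℕ d → ∀ xs → descList c d xs ≡ cdPairs false xs
  descList≡cdPairs c<d []       = refl
  descList≡cdPairs c<d (x ∷ xs) = after x xs
    where
    after : ∀ (x : Letter r n) xs → descList c d (x ∷ xs) ≡ cdPairs (isC (proj₂ x)) xs
    after x []       = refl
    after x (y ∷ ys) = cong₂ _+_ (cong ⟦_⟧ (descent⇔cd-colours c<d x y)) (after y ys)

  firsts : ∀ {k} → Vec (Letter r n) k → List (Fin n)
  firsts v = map proj₁ (toList v)

  uniqueᵇ : List (Fin n) → Bool
  uniqueᵇ as = does (UniqueDec.unique? _≟_ as)

  partialPerms : ℕ → Bool → ℕ → ℕ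
  partialPerms k s m = ∑[ v ∈ allVecs (allLetters r n) k ] (⟦ uniqueᵇ (firsts v) ⟧ * ⟦ cdPairs s (toList v) ≡ᵇ m ⟧)

  ∑-∉ᵇ-unique : ∀ as → (∑[ a < n ] ⟦ a ∉ᵇ as ⟧) * ⟦ uniqueᵇ as ⟧ ≡ (n ∸ length as) * ⟦ uniqueᵇ as ⟧
  ∑-∉ᵇ-unique as with UniqueDec.unique? _≟_ as
  ... | yes unique-as = cong (_* 1) (∑-∉ᵇ {n} unique-as)
  ... | no  _         = trans (*-zeroʳ (∑[ a < n ] ⟦ a ∉ᵇ as ⟧)) (sym (*-zeroʳ (n ∸ length as)))

  partialPerms-count : ∀ k s m → partialPerms k s m ≡ (n P′ k) * colourings s k m
  partialPerms-count zero    s zero    = refl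
  partialPerms-count zero    s (suc m) = refl
  partialPerms-count (suc k) s m = begin
    partialPerms (suc k) s m
      ≡⟨ ∑ᴸ-concatMap L (λ x → map (x ∷_) V) summand ⟩
    ∑[ x ∈ L ] ∑ᴸ (map (x ∷_) V) summand
      ≡⟨ ∑ᴸ-cong L (λ x → ∑ᴸ-map V (x ∷_) summand) ⟩
    ∑[ x ∈ L ] ∑[ v ∈ V ] summand (x ∷ v)
      ≡⟨ ∑ᴸ-allLetters (λ x → ∑[ v ∈ V ] summand (x ∷ v)) ⟩
    ∑[ a < n ] ∑[ col < r ] ∑[ v ∈ V ] summand ((a , col) ∷ v)
      ≡⟨ sum-cong-≗ (λ a → ∑-∑ᴸ-comm r V (λ col v → summand ((a , col) ∷ v))) ⟩
    ∑[ a < n ] ∑[ v ∈ V ] ∑[ col < r ] summand ((a , col) ∷ v)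
      ≡⟨ ∑-∑ᴸ-comm n V (λ a v → ∑[ col < r ] summand ((a , col) ∷ v)) ⟩
    ∑[ v ∈ V ] ∑[ a < n ] ∑[ col < r ] summand ((a , col) ∷ v)
      ≡⟨ ∑ᴸ-cong V prepend-letter ⟩
    ∑[ v ∈ V ] ((n ∸ k) * (⟦ U v ⟧ * ∑[ col < r ] next col v))
      ≡⟨ ∑ᴸ-*ˡ V (n ∸ k) (λ v → ⟦ U v ⟧ * ∑[ col < r ] next col v) ⟩
    (n ∸ k) * ∑[ v ∈ V ] (⟦ U v ⟧ * ∑[ col < r ] next col v)
      ≡⟨ cong ((n ∸ k) *_) (∑ᴸ-cong V (λ v → *-distribˡ-sum ⟦ U v ⟧ (λ col → next col v))) ⟩
    (n ∸ k) * ∑[ v ∈ V ] ∑[ col < r ] (⟦ U v ⟧ * next col v)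
      ≡⟨ cong ((n ∸ k) *_) (∑-∑ᴸ-comm r V (λ col v → ⟦ U v ⟧ * next col v)) ⟨
    (n ∸ k) * ∑[ col < r ] ∑[ v ∈ V ] (⟦ U v ⟧ * next col v)
      ≡⟨ cong ((n ∸ k) *_) (sum-cong-≗ per-colour) ⟩
    (n ∸ k) * ∑[ col < r ] ((n P′ k) * shiftIf (s ∧ isD col) (colourings (isC col) k) m)
      ≡⟨ cong ((n ∸ k) *_) (*-distribˡ-sum (n P′ k) (λ col → shiftIf (s ∧ isD col) (colourings (isC col) k) m)) ⟨
    (n ∸ k) * ((n P′ k) * colourings s (suc k) m)
      ≡⟨ *-assoc (n ∸ k) (n P′ k) _ ⟨
    (n P′ suc k) * colourings s (suc k) m ∎
    where
    open ≡-Reasoning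
    L = allLetters r n
    V = allVecs L k
    U : Vec (Letter r n) k → Bool
    U v = uniqueᵇ (firsts v)
    summand : Vec (Letter r n) (suc k) → ℕ
    summand w = ⟦ uniqueᵇ (firsts w) ⟧ * ⟦ cdPairs s (toList w) ≡ᵇ m ⟧
    next : Fin r → Vec (Letter r n) k → ℕ
    next col v = ⟦ ⟦ s ∧ isD col ⟧ + cdPairs (isC col) (toList v) ≡ᵇ m ⟧

    prepend-letter : ∀ v → ∑[ a < n ] ∑[ col < r ] summand ((a , col) ∷ v)
                         ≡ (n ∸ k) * (⟦ U v ⟧ * ∑[ col < r ] next col v)
    prepend-letter v = begin
      ∑[ a < n ] ∑[ col < r ] (⟦ (a ∉ᵇ as) ∧ U v ⟧ * next col v)
        ≡⟨ sum-cong-≗ (λ a → sum-cong-≗ (λ col →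
             trans (cong (_* next col v) (⟦∧⟧ (a ∉ᵇ as) (U v))) (*-assoc ⟦ a ∉ᵇ as ⟧ ⟦ U v ⟧ (next col v)))) ⟩
      ∑[ a < n ] ∑[ col < r ] (⟦ a ∉ᵇ as ⟧ * (⟦ U v ⟧ * next col v))
        ≡⟨ sum-cong-≗ (λ a → *-distribˡ-sum ⟦ a ∉ᵇ as ⟧ (λ col → ⟦ U v ⟧ * next col v)) ⟨
      ∑[ a < n ] (⟦ a ∉ᵇ as ⟧ * ∑[ col < r ] (⟦ U v ⟧ * next col v))
        ≡⟨ *-distribʳ-sum (∑[ col < r ] (⟦ U v ⟧ * next col v)) (λ a → ⟦ a ∉ᵇ as ⟧) ⟨
      (∑[ a < n ] ⟦ a ∉ᵇ as ⟧) * ∑[ col < r ] (⟦ U v ⟧ * next col v)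
        ≡⟨ cong ((∑[ a < n ] ⟦ a ∉ᵇ as ⟧) *_) (*-distribˡ-sum ⟦ U v ⟧ (λ col → next col v)) ⟨
      (∑[ a < n ] ⟦ a ∉ᵇ as ⟧) * (⟦ U v ⟧ * N)
        ≡⟨ *-assoc (∑[ a < n ] ⟦ a ∉ᵇ as ⟧) ⟦ U v ⟧ N ⟨
      (∑[ a < n ] ⟦ a ∉ᵇ as ⟧) * ⟦ U v ⟧ * N
        ≡⟨ cong (_* N) (∑-∉ᵇ-unique as) ⟩
      (n ∸ length as) * ⟦ U v ⟧ * N
        ≡⟨ *-assoc (n ∸ length as) ⟦ U v ⟧ N ⟩
      (n ∸ length as) * (⟦ U v ⟧ * N)
        ≡⟨ cong (λ l → (n ∸ l) * (⟦ U v ⟧ * N)) (trans (length-map proj₁ (toList v)) (length-toList v)) ⟩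
      (n ∸ k) * (⟦ U v ⟧ * N) ∎
      where
      as = firsts v
      N = ∑[ col < r ] next col v

    per-colour : ∀ col → ∑[ v ∈ V ] (⟦ U v ⟧ * next col v)
                       ≡ (n P′ k) * shiftIf (s ∧ isD col) (colourings (isC col) k) m
    per-colour col = begin
      ∑[ v ∈ V ] (⟦ U v ⟧ * next col v)
        ≡⟨ ∑ᴸ-shiftIf V (λ v → ⟦ U v ⟧) (λ v → cdPairs (isC col) (toList v)) (s ∧ isD col) m ⟩
      shiftIf (s ∧ isD col) (partialPerms k (isC col)) m
        ≡⟨ shiftIf-cong (s ∧ isD col) (partialPerms-count k (isC col)) m ⟩
      shiftIf (s ∧ isD col) (λ i → (n P′ k) * colourings (isC col) k i) m
        ≡⟨ shiftIf-*ˡ (s ∧ isD col) (n P′ k) (colourings (isC col) k) m ⟩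
      (n P′ k) * shiftIf (s ∧ isD col) (colourings (isC col) k) m ∎

nP′n≡n! : ∀ n → n P′ n ≡ n !
nP′n≡n! n = trans (nP′k≡n!/[n∸k]! (≤-refl {n})) (trans (/-congʳ ⦃ (n ∸ n) !≢0 ⦄ (cong _! (n∸n≡0 n))) (n/1≡n (n !)))

countDes≡n!*colourings : ∀ {r n} {c d : Fin r} → toℕ c < toℕ d → ∀ m →
  countDes r n c d m ≡ n ! * Colourings.colourings c d false n m
countDes≡n!*colourings {r} {n} {c} {d} c<d m = begin
  countDes r n c d m
    ≡⟨ length-filter-filter (λ w → desCount c d w ≟ℕ m) isColoredPerm? (allVecs (allLetters r n) n) ⟩
  ∑[ w ∈ allVecs (allLetters r n) n ] (⟦ uniqueᵇ (firsts w) ⟧ * ⟦ desCount c d w ≡ᵇ m ⟧)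
    ≡⟨ ∑ᴸ-cong (allVecs (allLetters r n) n)
         (λ w → cong (λ k → ⟦ uniqueᵇ (firsts w) ⟧ * ⟦ k ≡ᵇ m ⟧) (descList≡cdPairs c<d (toList w))) ⟩
  partialPerms n false m
    ≡⟨ partialPerms-count n false m ⟩
  (n P′ n) * colourings false n m
    ≡⟨ cong (_* colourings false n m) (nP′n≡n! n) ⟩
  n ! * colourings false n m ∎
  where
  open ≡-Reasoning
  open Colourings c d
  open Counting {n = n} c d

module _ {p : ℕ} {c d : Fin (suc (suc p))} (c≢d : c ≢ d) where

  open Colourings c d
  open Transfer p (suc p)

  colourings≡walks : ∀ k → (∀ m → colourings false k m ≡ walksO k m) × (∀ m → colourings true k m ≡ walksC k m)
  colourings≡walks zero    = (λ m → sym (trans (walkO-zero 0 m) (*-identityʳ (δ₀ m)))) , (λ m → refl)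
  colourings≡walks (suc k) = fromO , fromC
    where
    open ≡-Reasoning
    O≡ = proj₁ (colourings≡walks k)
    C≡ = proj₂ (colourings≡walks k)
    fromO : ∀ m → colourings false (suc k) m ≡ walksO (suc k) m
    fromO m = begin
      colourings false (suc k) m
        ≡⟨ colourings-suc c≢d false k m ⟩
      colourings true k m + suc p * colourings false k m
        ≡⟨ cong₂ (λ x y → x + suc p * y) (C≡ m) (O≡ m) ⟩
      walksC k m + suc p * walksO k m
        ≡⟨ walksO-suc k m ⟨
      walksO (suc k) m ∎
    fromC : ∀ m → colourings true (suc k) m ≡ walksC (suc k) m
    fromC m = begin
      colourings true (suc k) m
        ≡⟨ colourings-suc c≢d true k m ⟩
      colourings true k m + (shift (colourings false k) m + p * colourings false k m)
        ≡⟨ cong₂ _+_ (C≡ m) (cong₂ _+_ (shiftIf-cong true O≡ m) (cong (p *_) (O≡ m))) ⟩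
      walksC k m + [t+p]* walksO k ⟨ m ⟩
        ≡⟨ walksC-suc k m ⟨
      walksC (suc k) m ∎

module _ (p n′ : ℕ) where

  open Transfer p (suc p)

  private
    n = suc n′

  binomialSum : (ℕ → ℕ) → ℕ
  binomialSum y = sumRange 1 n′ (λ k → sumRange 1 k (λ b → (k C b) * ((n ∸ k) C b) * y b * suc p ^ (n ∸ k ∸ b)))

  binomialSum-cong : ∀ {y z : ℕ → ℕ} → (∀ b → y b ≡ z b) → binomialSum y ≡ binomialSum z
  binomialSum-cong y≡z = sumRange-cong 1 n′ (λ k → sumRange-cong 1 k (λ b →
    cong (λ x → (k C b) * ((n ∸ k) C b) * x * suc p ^ (n ∸ k ∸ b)) (y≡z b)))

  formula0≡walksO : formula0 (suc (suc p)) n ≡ n ! * walksO n 0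
  formula0≡walksO = begin
    n ! * geometric + n ! * binomialSum (p ^_)
      ≡⟨ *-distribˡ-+ (n !) geometric (binomialSum (p ^_)) ⟨
    n ! * (geometric + binomialSum (p ^_))
      ≡⟨ cong₂ (λ x y → n ! * (x + y)) (*-identityˡ geometric)
               (binomialSum-cong (λ b → trans ([t+p]^-coeff b 0) (*-identityˡ (p ^ b)))) ⟨
    n ! * (δ₀ 0 * geometric + binomialSum [t+p]^_⟨ 0 ⟩)
      ≡⟨ cong (n ! *_) (walksO-closed n′ 0) ⟨
    n ! * walksO n 0 ∎
    where
    open ≡-Reasoning
    geometric = sumRange 0 n (suc p ^_)

  formulaM≡walksO : ∀ m → formulaM (suc (suc p)) n (suc m) ≡ n ! * walksO n (suc m)
  formulaM≡walksO m = cong (n ! *_) (begin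
    sumRange 1 n′ (λ k → sumRange 1 k (λ b → (k C b) * ((n ∸ k) C b) * (b C suc m) * p ^ (b ∸ suc m) * suc p ^ (n ∸ k ∸ b)))
      ≡⟨ sumRange-cong 1 n′ (λ k → sumRange-cong 1 k (λ b →
           cong (_* suc p ^ (n ∸ k ∸ b)) (*-assoc ((k C b) * ((n ∸ k) C b)) (b C suc m) (p ^ (b ∸ suc m))))) ⟩
    binomialSum (λ b → (b C suc m) * p ^ (b ∸ suc m))
      ≡⟨ binomialSum-cong (λ b → [t+p]^-coeff b (suc m)) ⟨
    binomialSum [t+p]^_⟨ suc m ⟩
      ≡⟨ walksO-closed n′ (suc m) ⟨
    walksO n (suc m) ∎)
    where open ≡-Reasoning

proposition5 : (r n : ℕ) (c d : Fin r) → 2 ≤ r → 1 ≤ n → toℕ c < toℕ d →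
    (countDes r n c d 0 ≡ formula0 r n)
    × ((m : ℕ) → 0 < m → countDes r n c d m ≡ formulaM r n m)
proposition5 (suc (suc p)) (suc n′) c d (s≤s (s≤s z≤n)) (s≤s z≤n) c<d = no-descents , some-descents
  where
  open Transfer p (suc p)
  c≢d : c ≢ d
  c≢d refl = <-irrefl refl c<d
  count : ∀ m → countDes (suc (suc p)) (suc n′) c d m ≡ suc n′ ! * walksO (suc n′) m
  count m = trans (countDes≡n!*colourings {n = suc n′} c<d m) (cong (suc n′ ! *_) (proj₁ (colourings≡walks c≢d (suc n′)) m))
  no-descents : countDes (suc (suc p)) (suc n′) c d 0 ≡ formula0 (suc (suc p)) (suc n′)
  no-descents = trans (count 0) (sym (formula0≡walksO p n′))
  some-descents : ∀ m → 0 < m → countDes (suc (suc p)) (suc n′) c d m ≡ formulaM (suc (suc p)) (suc n′) m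
  some-descents (suc m) _ = trans (count (suc m)) (sym (formulaM≡walksO p n′ m))
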